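{- Let $\Gamma$ be a relevant collection such that $\Gamma-\{S\}$ is an hke collection for each $S\in\Gamma$. Then there exists an integer $m$ such that $$\Big|\bigcap\Gamma_1-\bigcup\Gamma_2\Big|-\Big|\bigcap\Gamma_2-\bigcup\Gamma_1\Big|=(-1)^{|\Gamma_1|+1}m$$ holds for every partition $\{\Gamma_1,\Gamma_2\}$ of $\Gamma$ into two non-empty subcollections.
   Context: A relevant collection is a finite collection $F$ of finite sets all having the same cardinality, a positive integer denoted $\alpha(F)$. A collection $F$ of sets is an hereditary Konig–Egervary (hke) collection if there is a positive integer $\alpha$ such that $|\bigcup\Gamma|+|\bigcap\Gamma|=2\alpha$ for every non-empty subcollection $\Gamma\subseteq F$. -}

module Defs where

open import Data.Nat using (ℕ; _+_; _*_; _<_)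
open import Data.Fin using (Fin)
open import Data.Fin.Subset using (Subset; ⋃; ⋂; ∣_∣; Nonempty; _⊆_; _∈_; _─_; ∁; ⁅_⁆; _∪_; _∩_)
open import Data.Fin.Subset.Properties using (_∈?_)
open import Data.List using (List; map; filter)
open import Data.List.Base using (allFin)
open import Data.Product using (Σ; _×_)
open import Function.Definitions using (Injective)
open import Relation.Binary.PropositionalEquality using (_≡_)

-- A collection of k sets over the finite ground set Fin u, given by an
-- injective family F : Fin k → Subset u (injective = the sets are distinct).
-- A subcollection is a subset Δ : Subset k of the indices.

members : ∀ {u k} → (Fin k → Subset u) → Subset k → List (Subset u)
members F Δ = map F (filter (_∈? Δ) (allFin _))

-- ⋃Δ and ⋂Δ (the latter only meaningful for non-empty Δ; it is then the
-- usual intersection of the member sets)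
⋃[_] : ∀ {u k} → (Fin k → Subset u) → Subset k → Subset u
⋃[ F ] Δ = ⋃ (members F Δ)

⋂[_] : ∀ {u k} → (Fin k → Subset u) → Subset k → Subset u
⋂[ F ] Δ = ⋂ (members F Δ)

Relevant : ∀ {u k} → (Fin k → Subset u) → Set
Relevant {k = k} F =
  Injective _≡_ _≡_ F × (0 < k) ×
  Σ ℕ (λ α → (0 < α) × (∀ i → ∣ F i ∣ ≡ α))

HKE-sub : ∀ {u k} → (Fin k → Subset u) → Subset k → Set
HKE-sub F Γ' = Σ ℕ (λ α → (0 < α) ×
  (∀ (Δ : Subset _) → Nonempty Δ → Δ ⊆ Γ' →
     ∣ ⋃[ F ] Δ ∣ + ∣ ⋂[ F ] Δ ∣ ≡ 2 * α))

open import Data.Integer using (ℤ; +_; -[1+_])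
signPow : ℕ → ℤ
signPow ℕ.zero = + 1
signPow (ℕ.suc ℕ.zero) = -[1+ 0 ]
signPow (ℕ.suc (ℕ.suc n)) = signPow n

module Submission where

-- Exchange lemma: if |⋃Δ| + |⋂Δ| is constant over the non-empty Δ ⊆ Φ, then
-- excl B C = excl C B for non-empty B, C ⊆ Φ (induction on C, splitting
-- excl B C by membership in one more set).  Applied inside Γ − {y} to B and
-- ∁(B ∪ {y}) it gives the flip rule imbalance (B ∪ {y}) = − imbalance B for
-- proper B ∪ {y}.  Removing the points of Γ₁ one by one gives
-- imbalance Γ₁ = (−1)^(|Γ₁|−1) imbalance {a} for a ∈ Γ₁, and all singletons
-- have the same imbalance (flip rule for ≥ 3 sets, equal sizes for 2 sets).

open import Defs
open import Data.Bool using (_∧_)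
open import Data.Nat using (ℕ; zero; suc; _+_)
open import Data.Nat.Properties using (+-suc; +-comm; +-assoc; +-cancelʳ-≡; suc-injective)
open import Data.Integer using (ℤ; +_; -_; _-_; _*_; _⊖_)
open import Data.Integer.Properties using (m-n≡m⊖n; +-cancelˡ-⊖; ⊖-swap; neg-distribˡ-*; neg-involutive; *-identityˡ)
open import Data.Fin using (Fin; zero; suc)
open import Data.Fin.Subset using (Subset; inside; outside; ⊥; ⊤; ⁅_⁆; _∪_; _∩_; _─_; ∁; ⋃; ⋂; ∣_∣; _∈_; _∉_; _⊆_; Nonempty)
open import Data.Fin.Subset.Properties using (_∈?_; ∈⊤; ∉⊥; x∈⁅x⁆; x∈⁅y⁆⇒x≡y; x≢y⇒x∉⁅y⁆; x∈p∪q⁺; x∈p∪q⁻; x∈p∩q⁺; x∈p∩q⁻; x∈p∧x∉q⇒x∈p─q; p─q⊆p; p─q─r≡p─q∪r; x∈p⇒x∉∁p; x∈∁p⇒x∉p; x∉p⇒x∈∁p; ⊆-antisym; ∪-comm; ∪-assoc; ∪-identityˡ; ∪-identityʳ; nonempty?; Empty-unique; ∣⊥∣≡0)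
open import Data.Vec using ([]; _∷_; here; there)
open import Data.List using ([]; _∷_; allFin)
open import Data.List.Membership.Propositional using () renaming (_∈_ to _∈ₗ_)
open import Data.List.Membership.Propositional.Properties using (∈-map⁺; ∈-map⁻; ∈-filter⁺; ∈-filter⁻; ∈-allFin)
open import Data.List.Relation.Unary.Any using () renaming (here to hereₗ; there to thereₗ)
open import Data.Product using (Σ; ∃-syntax; _×_; _,_; proj₁; proj₂)
open import Data.Sum using (inj₁; inj₂; [_,_])
open import Relation.Nullary using (yes; no; contradiction)
open import Relation.Binary.PropositionalEquality using (_≡_; _≢_; refl; sym; trans; cong; cong₂; subst; module ≡-Reasoning)
open ≡-Reasoning
open import Function using (_∘_)

∣p─q∣+∣p∩q∣≡∣p∣ : ∀ {n} (p q : Subset n) → ∣ p ─ q ∣ + ∣ p ∩ q ∣ ≡ ∣ p ∣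
∣p─q∣+∣p∩q∣≡∣p∣ []            []            = refl
∣p─q∣+∣p∩q∣≡∣p∣ (inside ∷ p)  (inside ∷ q)  = trans (+-suc _ _) (cong suc (∣p─q∣+∣p∩q∣≡∣p∣ p q))
∣p─q∣+∣p∩q∣≡∣p∣ (inside ∷ p)  (outside ∷ q) = cong suc (∣p─q∣+∣p∩q∣≡∣p∣ p q)
∣p─q∣+∣p∩q∣≡∣p∣ (outside ∷ p) (inside ∷ q)  = ∣p─q∣+∣p∩q∣≡∣p∣ p q
∣p─q∣+∣p∩q∣≡∣p∣ (outside ∷ p) (outside ∷ q) = ∣p─q∣+∣p∩q∣≡∣p∣ p q

∣q─p∣+∣p∣≡∣p∪q∣ : ∀ {n} (p q : Subset n) → ∣ q ─ p ∣ + ∣ p ∣ ≡ ∣ p ∪ q ∣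
∣q─p∣+∣p∣≡∣p∪q∣ []            []            = refl
∣q─p∣+∣p∣≡∣p∪q∣ (inside ∷ p)  (inside ∷ q)  = trans (+-suc _ _) (cong suc (∣q─p∣+∣p∣≡∣p∪q∣ p q))
∣q─p∣+∣p∣≡∣p∪q∣ (inside ∷ p)  (outside ∷ q) = trans (+-suc _ _) (cong suc (∣q─p∣+∣p∣≡∣p∪q∣ p q))
∣q─p∣+∣p∣≡∣p∪q∣ (outside ∷ p) (inside ∷ q)  = cong suc (∣q─p∣+∣p∣≡∣p∪q∣ p q)
∣q─p∣+∣p∣≡∣p∪q∣ (outside ∷ p) (outside ∷ q) = ∣q─p∣+∣p∣≡∣p∪q∣ p q

∣p∪⁅y⁆∣≡1+∣p∣ : ∀ {n} (p : Subset n) y → y ∉ p → ∣ p ∪ ⁅ y ⁆ ∣ ≡ suc ∣ p ∣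
∣p∪⁅y⁆∣≡1+∣p∣ (inside ∷ p)  zero    y∉p = contradiction here y∉p
∣p∪⁅y⁆∣≡1+∣p∣ (outside ∷ p) zero    _   = cong (suc ∘ ∣_∣) (∪-identityʳ p)
∣p∪⁅y⁆∣≡1+∣p∣ (inside ∷ p)  (suc y) y∉p = cong suc (∣p∪⁅y⁆∣≡1+∣p∣ p y (y∉p ∘ there))
∣p∪⁅y⁆∣≡1+∣p∣ (outside ∷ p) (suc y) y∉p = ∣p∪⁅y⁆∣≡1+∣p∣ p y (y∉p ∘ there)

p─q∩r≡p∩r─q : ∀ {n} (p q r : Subset n) → (p ─ q) ∩ r ≡ p ∩ r ─ q
p─q∩r≡p∩r─q []      []            []      = refl
p─q∩r≡p∩r─q (s ∷ p) (inside ∷ q)  (t ∷ r) = cong (outside ∷_) (p─q∩r≡p∩r─q p q r)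
p─q∩r≡p∩r─q (s ∷ p) (outside ∷ q) (t ∷ r) = cong (s ∧ t ∷_) (p─q∩r≡p∩r─q p q r)

∁[p∪q]≡∁p─q : ∀ {n} (p q : Subset n) → ∁ (p ∪ q) ≡ ∁ p ─ q
∁[p∪q]≡∁p─q []            []            = refl
∁[p∪q]≡∁p─q (inside ∷ p)  (inside ∷ q)  = cong (outside ∷_) (∁[p∪q]≡∁p─q p q)
∁[p∪q]≡∁p─q (inside ∷ p)  (outside ∷ q) = cong (outside ∷_) (∁[p∪q]≡∁p─q p q)
∁[p∪q]≡∁p─q (outside ∷ p) (inside ∷ q)  = cong (outside ∷_) (∁[p∪q]≡∁p─q p q)
∁[p∪q]≡∁p─q (outside ∷ p) (outside ∷ q) = cong (inside ∷_) (∁[p∪q]≡∁p─q p q)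

p─q∪q≡p : ∀ {n} (p q : Subset n) → q ⊆ p → (p ─ q) ∪ q ≡ p
p─q∪q≡p p q q⊆p = ⊆-antisym (λ x∈ → [ (p─q⊆p p q) , q⊆p ] (x∈p∪q⁻ (p ─ q) q x∈)) back
  where
  back : p ⊆ (p ─ q) ∪ q
  back {x} x∈p with x ∈? q
  ... | yes x∈q = x∈p∪q⁺ (inj₂ x∈q)
  ... | no  x∉q = x∈p∪q⁺ (inj₁ (x∈p∧x∉q⇒x∈p─q x∈p x∉q))

⁅x⁆⊆p : ∀ {n} {x : Fin n} {p} → x ∈ p → ⁅ x ⁆ ⊆ p
⁅x⁆⊆p {x = x} x∈p y∈⁅x⁆ = subst (_∈ _) (sym (x∈⁅y⁆⇒x≡y x y∈⁅x⁆)) x∈p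

y∈p∪⁅y⁆ : ∀ {n} {p : Subset n} y → y ∈ p ∪ ⁅ y ⁆
y∈p∪⁅y⁆ y = x∈p∪q⁺ (inj₂ (x∈⁅x⁆ y))

y∉p─⁅y⁆ : ∀ {n} (p : Subset n) y → y ∉ p ─ ⁅ y ⁆
y∉p─⁅y⁆ (s ∷ p) zero    ()
y∉p─⁅y⁆ (s ∷ p) (suc y) (there y∈) = y∉p─⁅y⁆ p y y∈

p─⁅y⁆∪⁅y⁆≡p : ∀ {n} {p : Subset n} {y} → y ∈ p → (p ─ ⁅ y ⁆) ∪ ⁅ y ⁆ ≡ p
p─⁅y⁆∪⁅y⁆≡p {p = p} {y} y∈p = p─q∪q≡p p ⁅ y ⁆ (⁅x⁆⊆p y∈p)

∣p∣≡1+∣p─⁅y⁆∣ : ∀ {n} {p : Subset n} {y} → y ∈ p → ∣ p ∣ ≡ suc ∣ p ─ ⁅ y ⁆ ∣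
∣p∣≡1+∣p─⁅y⁆∣ {p = p} {y} y∈p =
  trans (cong ∣_∣ (sym (p─⁅y⁆∪⁅y⁆≡p y∈p))) (∣p∪⁅y⁆∣≡1+∣p∣ (p ─ ⁅ y ⁆) y (y∉p─⁅y⁆ p y))

size-zero⇒⊥ : ∀ {n} (p : Subset n) → ∣ p ∣ ≡ 0 → p ≡ ⊥
size-zero⇒⊥ p ∣p∣≡0 = Empty-unique λ (y , y∈p) → contradiction (trans (sym ∣p∣≡0) (∣p∣≡1+∣p─⁅y⁆∣ y∈p)) λ ()

nonempty-of-size : ∀ {n} (p : Subset n) {m} → ∣ p ∣ ≡ suc m → Nonempty p
nonempty-of-size {n} p ∣p∣≡1+m with nonempty? p
... | yes ne  = ne
... | no  ¬ne = contradiction (trans (sym ∣p∣≡1+m) (trans (cong ∣_∣ (Empty-unique ¬ne)) (∣⊥∣≡0 n))) λ ()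

subset-induction : ∀ {n} (P : Subset n → Set) → P ⊥ →
  (∀ A y → y ∉ A → P A → P (A ∪ ⁅ y ⁆)) → ∀ A → P A
subset-induction P base step A = by-size ∣ A ∣ A refl
  where
  by-size : ∀ m A → ∣ A ∣ ≡ m → P A
  by-size zero    A ∣A∣≡0   = subst P (sym (size-zero⇒⊥ A ∣A∣≡0)) base
  by-size (suc m) A ∣A∣≡1+m =
    let (y , y∈A) = nonempty-of-size A ∣A∣≡1+m
        ∣A─y∣≡m  = suc-injective (trans (sym (∣p∣≡1+∣p─⁅y⁆∣ y∈A)) ∣A∣≡1+m)
    in subst P (p─⁅y⁆∪⁅y⁆≡p y∈A)
         (step (A ─ ⁅ y ⁆) y (y∉p─⁅y⁆ A y) (by-size m (A ─ ⁅ y ⁆) ∣A─y∣≡m))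

∈⋂⁺ : ∀ {n} {x : Fin n} ps → (∀ {p} → p ∈ₗ ps → x ∈ p) → x ∈ ⋂ ps
∈⋂⁺ []       _   = ∈⊤
∈⋂⁺ (p ∷ ps) x∈ = x∈p∩q⁺ (x∈ (hereₗ refl) , ∈⋂⁺ ps (x∈ ∘ thereₗ))

∈⋂⁻ : ∀ {n} {x : Fin n} {p} ps → x ∈ ⋂ ps → p ∈ₗ ps → x ∈ p
∈⋂⁻ (q ∷ ps) x∈ (hereₗ refl) = proj₁ (x∈p∩q⁻ q (⋂ ps) x∈)
∈⋂⁻ (q ∷ ps) x∈ (thereₗ p∈) = ∈⋂⁻ ps (proj₂ (x∈p∩q⁻ q (⋂ ps) x∈)) p∈

∈⋃⁺ : ∀ {n} {x : Fin n} {p} ps → p ∈ₗ ps → x ∈ p → x ∈ ⋃ ps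
∈⋃⁺ (q ∷ ps) (hereₗ refl) x∈p = x∈p∪q⁺ (inj₁ x∈p)
∈⋃⁺ (q ∷ ps) (thereₗ p∈) x∈p = x∈p∪q⁺ (inj₂ (∈⋃⁺ ps p∈ x∈p))

∈⋃⁻ : ∀ {n} {x : Fin n} ps → x ∈ ⋃ ps → ∃[ p ] p ∈ₗ ps × x ∈ p
∈⋃⁻ []       x∈ = contradiction x∈ ∉⊥
∈⋃⁻ (q ∷ ps) x∈ with x∈p∪q⁻ q (⋃ ps) x∈
... | inj₁ x∈q = q , hereₗ refl , x∈q
... | inj₂ x∈⋃ = let (p , p∈ , x∈p) = ∈⋃⁻ ps x∈⋃ in p , thereₗ p∈ , x∈p

cancel-middle : ∀ {a b c d} → a + b ≡ c + d → b ≡ c → a ≡ d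
cancel-middle {a} {b} {_} {d} a+b≡b+d refl = +-cancelʳ-≡ b a d (trans a+b≡b+d (+-comm b d))

cancel-sizes : ∀ {x y i i' u u'} → x + i' ≡ i → y + u ≡ u' → u + i ≡ u' + i' → x ≡ y
cancel-sizes {x} {y} {i} {i'} {u} {u'} x+i'≡i y+u≡u' u+i≡u'+i' = +-cancelʳ-≡ (i' + u) x y (begin
  x + (i' + u)  ≡⟨ sym (+-assoc x i' u) ⟩
  x + i' + u    ≡⟨ cong (_+ u) x+i'≡i ⟩
  i + u         ≡⟨ +-comm i u ⟩
  u + i         ≡⟨ u+i≡u'+i' ⟩
  u' + i'       ≡⟨ cong (_+ i') (sym y+u≡u') ⟩
  y + u + i'    ≡⟨ +-assoc y u i' ⟩
  y + (u + i')  ≡⟨ cong (λ v → y + v) (+-comm u i') ⟩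
  y + (i' + u)  ∎)

opposite-differences : ∀ {a b c d} → a + c ≡ d + b → + c - + d ≡ - (+ a - + b)
opposite-differences {a} {b} {c} {d} a+c≡d+b = begin
  + c - + d          ≡⟨ m-n≡m⊖n c d ⟩
  c ⊖ d              ≡⟨ sym (+-cancelˡ-⊖ a c d) ⟩
  (a + c) ⊖ (a + d)  ≡⟨ cong₂ _⊖_ a+c≡d+b (+-comm a d) ⟩
  (d + b) ⊖ (d + a)  ≡⟨ +-cancelˡ-⊖ d b a ⟩
  b ⊖ a              ≡⟨ ⊖-swap b a ⟩
  - (a ⊖ b)          ≡⟨ cong -_ (sym (m-n≡m⊖n a b)) ⟩
  - (+ a - + b)      ∎

signPow-suc : ∀ n → signPow (suc n) ≡ - signPow n
signPow-suc zero          = refl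
signPow-suc (suc zero)    = refl
signPow-suc (suc (suc n)) = signPow-suc n

avoid⇒⊆⊤─⁅y⁆ : ∀ {k} {Δ : Subset k} {y} → y ∉ Δ → Δ ⊆ ⊤ ─ ⁅ y ⁆
avoid⇒⊆⊤─⁅y⁆ {Δ = Δ} {y} y∉Δ x∈Δ =
  x∈p∧x∉q⇒x∈p─q ∈⊤ (λ x∈⁅y⁆ → y∉Δ (subst (_∈ Δ) (x∈⁅y⁆⇒x≡y y x∈⁅y⁆) x∈Δ))

module _ {u k} (F : Fin k → Subset u) where

  ∈members⁺ : ∀ {Δ j} → j ∈ Δ → F j ∈ₗ members F Δ
  ∈members⁺ {Δ} {j} j∈Δ = ∈-map⁺ F (∈-filter⁺ (_∈? Δ) (∈-allFin j) j∈Δ)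

  ∈members⁻ : ∀ {Δ p} → p ∈ₗ members F Δ → ∃[ j ] j ∈ Δ × p ≡ F j
  ∈members⁻ {Δ} p∈ =
    let (j , j∈ , p≡Fj) = ∈-map⁻ F p∈ in j , proj₂ (∈-filter⁻ (_∈? Δ) {xs = allFin k} j∈) , p≡Fj

  ∈⋂[]⁺ : ∀ {Δ x} → (∀ {j} → j ∈ Δ → x ∈ F j) → x ∈ ⋂[ F ] Δ
  ∈⋂[]⁺ {Δ} {x} x∈F = ∈⋂⁺ (members F Δ) λ p∈ →
    let (j , j∈Δ , p≡Fj) = ∈members⁻ p∈ in subst (x ∈_) (sym p≡Fj) (x∈F j∈Δ)

  ∈⋂[]⁻ : ∀ {Δ x j} → x ∈ ⋂[ F ] Δ → j ∈ Δ → x ∈ F j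
  ∈⋂[]⁻ {Δ} x∈ j∈Δ = ∈⋂⁻ (members F Δ) x∈ (∈members⁺ j∈Δ)

  ∈⋃[]⁺ : ∀ {Δ x j} → j ∈ Δ → x ∈ F j → x ∈ ⋃[ F ] Δ
  ∈⋃[]⁺ {Δ} j∈Δ = ∈⋃⁺ (members F Δ) (∈members⁺ j∈Δ)

  ∈⋃[]⁻ : ∀ {Δ x} → x ∈ ⋃[ F ] Δ → ∃[ j ] j ∈ Δ × x ∈ F j
  ∈⋃[]⁻ {Δ} {x} x∈ =
    let (p , p∈ , x∈p)  = ∈⋃⁻ (members F Δ) x∈
        (j , j∈Δ , p≡Fj) = ∈members⁻ p∈
    in j , j∈Δ , subst (x ∈_) p≡Fj x∈p

  ⋂[]-∪ : ∀ A B → ⋂[ F ] (A ∪ B) ≡ ⋂[ F ] A ∩ ⋂[ F ] B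
  ⋂[]-∪ A B = ⊆-antisym to from
    where
    to : ⋂[ F ] (A ∪ B) ⊆ ⋂[ F ] A ∩ ⋂[ F ] B
    to x∈ = x∈p∩q⁺ (∈⋂[]⁺ (∈⋂[]⁻ x∈ ∘ x∈p∪q⁺ ∘ inj₁) , ∈⋂[]⁺ (∈⋂[]⁻ x∈ ∘ x∈p∪q⁺ ∘ inj₂))
    from : ⋂[ F ] A ∩ ⋂[ F ] B ⊆ ⋂[ F ] (A ∪ B)
    from x∈ = let (x∈⋂A , x∈⋂B) = x∈p∩q⁻ _ _ x∈ in
      ∈⋂[]⁺ λ j∈ → [ ∈⋂[]⁻ x∈⋂A , ∈⋂[]⁻ x∈⋂B ] (x∈p∪q⁻ A B j∈)

  ⋃[]-∪ : ∀ A B → ⋃[ F ] (A ∪ B) ≡ ⋃[ F ] A ∪ ⋃[ F ] B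
  ⋃[]-∪ A B = ⊆-antisym to from
    where
    to : ⋃[ F ] (A ∪ B) ⊆ ⋃[ F ] A ∪ ⋃[ F ] B
    to x∈ = let (j , j∈ , x∈Fj) = ∈⋃[]⁻ x∈ in
      [ (λ j∈A → x∈p∪q⁺ (inj₁ (∈⋃[]⁺ j∈A x∈Fj))) , (λ j∈B → x∈p∪q⁺ (inj₂ (∈⋃[]⁺ j∈B x∈Fj))) ]
        (x∈p∪q⁻ A B j∈)
    from : ⋃[ F ] A ∪ ⋃[ F ] B ⊆ ⋃[ F ] (A ∪ B)
    from x∈ with x∈p∪q⁻ _ _ x∈
    ... | inj₁ x∈⋃A = let (j , j∈A , x∈Fj) = ∈⋃[]⁻ x∈⋃A in ∈⋃[]⁺ (x∈p∪q⁺ (inj₁ j∈A)) x∈Fj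
    ... | inj₂ x∈⋃B = let (j , j∈B , x∈Fj) = ∈⋃[]⁻ x∈⋃B in ∈⋃[]⁺ (x∈p∪q⁺ (inj₂ j∈B)) x∈Fj

  ⋂[]-⁅⁆ : ∀ c → ⋂[ F ] ⁅ c ⁆ ≡ F c
  ⋂[]-⁅⁆ c = ⊆-antisym (λ x∈ → ∈⋂[]⁻ x∈ (x∈⁅x⁆ c))
    λ {x} x∈Fc → ∈⋂[]⁺ λ j∈ → subst (λ j → x ∈ F j) (sym (x∈⁅y⁆⇒x≡y c j∈)) x∈Fc

  ⋃[]-⁅⁆ : ∀ c → ⋃[ F ] ⁅ c ⁆ ≡ F c
  ⋃[]-⁅⁆ c = ⊆-antisym
    (λ {x} x∈ → let (j , j∈ , x∈Fj) = ∈⋃[]⁻ x∈ in subst (λ j → x ∈ F j) (x∈⁅y⁆⇒x≡y c j∈) x∈Fj)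
    (∈⋃[]⁺ (x∈⁅x⁆ c))

  ⋂[]-∪⁅⁆ : ∀ A c → ⋂[ F ] (A ∪ ⁅ c ⁆) ≡ ⋂[ F ] A ∩ F c
  ⋂[]-∪⁅⁆ A c = trans (⋂[]-∪ A ⁅ c ⁆) (cong (⋂[ F ] A ∩_) (⋂[]-⁅⁆ c))

  ⋃[]-∪⁅⁆ : ∀ A c → ⋃[ F ] (A ∪ ⁅ c ⁆) ≡ ⋃[ F ] A ∪ F c
  ⋃[]-∪⁅⁆ A c = trans (⋃[]-∪ A ⁅ c ⁆) (cong (⋃[ F ] A ∪_) (⋃[]-⁅⁆ c))

  excl : Subset k → Subset k → ℕ
  excl B C = ∣ ⋂[ F ] B ─ ⋃[ F ] C ∣

  -- The points counted by excl B C split according to membership in F c.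
  excl-split : ∀ B C c → excl B (C ∪ ⁅ c ⁆) + excl (B ∪ ⁅ c ⁆) C ≡ excl B C
  excl-split B C c = begin
    ∣ ⋂B ─ ⋃[ F ] (C ∪ ⁅ c ⁆) ∣ + ∣ ⋂[ F ] (B ∪ ⁅ c ⁆) ─ ⋃C ∣
      ≡⟨ cong₂ (λ U I → ∣ ⋂B ─ U ∣ + ∣ I ─ ⋃C ∣) (⋃[]-∪⁅⁆ C c) (⋂[]-∪⁅⁆ B c) ⟩
    ∣ ⋂B ─ (⋃C ∪ F c) ∣ + ∣ ⋂B ∩ F c ─ ⋃C ∣
      ≡⟨ cong₂ _+_ (cong ∣_∣ (sym (p─q─r≡p─q∪r ⋂B ⋃C (F c)))) (cong ∣_∣ (sym (p─q∩r≡p∩r─q ⋂B ⋃C (F c)))) ⟩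
    ∣ ⋂B ─ ⋃C ─ F c ∣ + ∣ (⋂B ─ ⋃C) ∩ F c ∣
      ≡⟨ ∣p─q∣+∣p∩q∣≡∣p∣ (⋂B ─ ⋃C) (F c) ⟩
    excl B C ∎
    where
    ⋂B = ⋂[ F ] B
    ⋃C = ⋃[ F ] C

  exchange-point : ∀ B c →
    ∣ ⋃[ F ] B ∣ + ∣ ⋂[ F ] B ∣ ≡ ∣ ⋃[ F ] (B ∪ ⁅ c ⁆) ∣ + ∣ ⋂[ F ] (B ∪ ⁅ c ⁆) ∣ →
    excl B ⁅ c ⁆ ≡ excl ⁅ c ⁆ B
  exchange-point B c same-sum = cancel-sizes outside-c inside-c same-sum
    where
    outside-c : excl B ⁅ c ⁆ + ∣ ⋂[ F ] (B ∪ ⁅ c ⁆) ∣ ≡ ∣ ⋂[ F ] B ∣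
    outside-c = trans (cong₂ (λ U I → ∣ ⋂[ F ] B ─ U ∣ + ∣ I ∣) (⋃[]-⁅⁆ c) (⋂[]-∪⁅⁆ B c))
                      (∣p─q∣+∣p∩q∣≡∣p∣ (⋂[ F ] B) (F c))
    inside-c : excl ⁅ c ⁆ B + ∣ ⋃[ F ] B ∣ ≡ ∣ ⋃[ F ] (B ∪ ⁅ c ⁆) ∣
    inside-c = begin
      excl ⁅ c ⁆ B + ∣ ⋃[ F ] B ∣        ≡⟨ cong (λ I → ∣ I ─ ⋃[ F ] B ∣ + ∣ ⋃[ F ] B ∣) (⋂[]-⁅⁆ c) ⟩
      ∣ F c ─ ⋃[ F ] B ∣ + ∣ ⋃[ F ] B ∣  ≡⟨ ∣q─p∣+∣p∣≡∣p∪q∣ (⋃[ F ] B) (F c) ⟩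
      ∣ ⋃[ F ] B ∪ F c ∣                 ≡⟨ cong ∣_∣ (sym (⋃[]-∪⁅⁆ B c)) ⟩
      ∣ ⋃[ F ] (B ∪ ⁅ c ⁆) ∣             ∎

  -- Induction on C: a
  -- singleton C is the one-point exchange, and adding a point d to a
  -- non-empty C is handled by excl-split and the exchange for B and B ∪ {d}.
  exchange : ∀ {Φ} → HKE-sub F Φ → ∀ {B C} →
    Nonempty B → Nonempty C → B ⊆ Φ → C ⊆ Φ → excl B C ≡ excl C B
  exchange {Φ} (_ , _ , sum≡2α) {B} {C} neB neC B⊆Φ =
    subset-induction Exchangeable (λ _ _ _ (_ , x∈⊥) → contradiction x∈⊥ ∉⊥) step C B neB B⊆Φ neC
    where
    Exchangeable : Subset k → Set
    Exchangeable C = ∀ B → Nonempty B → B ⊆ Φ → Nonempty C → C ⊆ Φ → excl B C ≡ excl C B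

    step : ∀ C d → d ∉ C → Exchangeable C → Exchangeable (C ∪ ⁅ d ⁆)
    step C d _ exchangeable B neB B⊆Φ _ C∪d⊆Φ with nonempty? C
    ... | no ¬neC rewrite Empty-unique ¬neC | ∪-identityˡ ⁅ d ⁆ =
      exchange-point B d (trans (sum≡2α B neB B⊆Φ) (sym (sum≡2α (B ∪ ⁅ d ⁆) (d , y∈p∪⁅y⁆ d) B∪d⊆Φ)))
      where
      B∪d⊆Φ : B ∪ ⁅ d ⁆ ⊆ Φ
      B∪d⊆Φ x∈ = [ B⊆Φ , C∪d⊆Φ ] (x∈p∪q⁻ B ⁅ d ⁆ x∈)
    ... | yes neC = cancel-middle
      (begin
        excl B (C ∪ ⁅ d ⁆) + excl (B ∪ ⁅ d ⁆) C  ≡⟨ excl-split B C d ⟩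
        excl B C                              ≡⟨ exchangeable B neB B⊆Φ neC C⊆Φ ⟩
        excl C B                              ≡⟨ sym (excl-split C B d) ⟩
        excl C (B ∪ ⁅ d ⁆) + excl (C ∪ ⁅ d ⁆) B  ∎)
      (exchangeable (B ∪ ⁅ d ⁆) (d , y∈p∪⁅y⁆ d) B∪d⊆Φ neC C⊆Φ)
      where
      C⊆Φ : C ⊆ Φ
      C⊆Φ = C∪d⊆Φ ∘ x∈p∪q⁺ ∘ inj₁
      B∪d⊆Φ : B ∪ ⁅ d ⁆ ⊆ Φ
      B∪d⊆Φ x∈ = [ B⊆Φ , C∪d⊆Φ ∘ x∈p∪q⁺ ∘ inj₂ ] (x∈p∪q⁻ B ⁅ d ⁆ x∈)

  imbalance : Subset k → ℤ
  imbalance A = + excl A (∁ A) - + excl (∁ A) A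

  -- Both B and C = ∁ (B ∪ {y}) avoid y, so
  -- excl B C = excl C B; splitting both sides by F y (excl-split) yields the
  -- four counts that define imbalance B and imbalance (B ∪ {y}).
  imbalance-flip : ∀ {B y} → HKE-sub F (⊤ ─ ⁅ y ⁆) → Nonempty B → y ∉ B →
    Nonempty (∁ (B ∪ ⁅ y ⁆)) → imbalance (B ∪ ⁅ y ⁆) ≡ - imbalance B
  imbalance-flip {B} {y} hke neB y∉B neC =
    opposite-differences {excl B (∁ B)} {excl (∁ B) B} {excl (B ∪ ⁅ y ⁆) C} {excl C (B ∪ ⁅ y ⁆)} (begin
    excl B (∁ B) + excl (B ∪ ⁅ y ⁆) C      ≡⟨ cong (λ D → excl B D + excl (B ∪ ⁅ y ⁆) C) (sym C∪y≡∁B) ⟩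
    excl B (C ∪ ⁅ y ⁆) + excl (B ∪ ⁅ y ⁆) C ≡⟨ excl-split B C y ⟩
    excl B C                              ≡⟨ exchange hke neB neC (avoid⇒⊆⊤─⁅y⁆ y∉B) (avoid⇒⊆⊤─⁅y⁆ y∉C) ⟩
    excl C B                              ≡⟨ sym (excl-split C B y) ⟩
    excl C (B ∪ ⁅ y ⁆) + excl (C ∪ ⁅ y ⁆) B ≡⟨ cong (λ D → excl C (B ∪ ⁅ y ⁆) + excl D B) C∪y≡∁B ⟩
    excl C (B ∪ ⁅ y ⁆) + excl (∁ B) B      ∎)
    where
    C = ∁ (B ∪ ⁅ y ⁆)
    y∉C : y ∉ C
    y∉C = x∈p⇒x∉∁p (y∈p∪⁅y⁆ y)
    C∪y≡∁B : C ∪ ⁅ y ⁆ ≡ ∁ B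
    C∪y≡∁B = trans (cong (_∪ ⁅ y ⁆) (∁[p∪q]≡∁p─q B ⁅ y ⁆)) (p─⁅y⁆∪⁅y⁆≡p (x∉p⇒x∈∁p y∉B))

  alternation : (∀ i → HKE-sub F (⊤ ─ ⁅ i ⁆)) → ∀ a A → a ∉ A → Nonempty (∁ (A ∪ ⁅ a ⁆)) →
    imbalance (A ∪ ⁅ a ⁆) ≡ signPow ∣ A ∣ * imbalance ⁅ a ⁆
  alternation hke a = subset-induction Alternates base step
    where
    Alternates : Subset k → Set
    Alternates A = a ∉ A → Nonempty (∁ (A ∪ ⁅ a ⁆)) →
      imbalance (A ∪ ⁅ a ⁆) ≡ signPow ∣ A ∣ * imbalance ⁅ a ⁆

    base : Alternates ⊥
    base _ _ = begin
      imbalance (⊥ ∪ ⁅ a ⁆)          ≡⟨ cong imbalance (∪-identityˡ ⁅ a ⁆) ⟩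
      imbalance ⁅ a ⁆                ≡⟨ sym (*-identityˡ (imbalance ⁅ a ⁆)) ⟩
      signPow 0 * imbalance ⁅ a ⁆    ≡⟨ cong (λ n → signPow n * imbalance ⁅ a ⁆) (sym (∣⊥∣≡0 k)) ⟩
      signPow ∣ ⊥ {n = k} ∣ * imbalance ⁅ a ⁆ ∎

    step : ∀ A y → y ∉ A → Alternates A → Alternates (A ∪ ⁅ y ⁆)
    step A y y∉A alternates a∉A∪y ne∁ = begin
      imbalance ((A ∪ ⁅ y ⁆) ∪ ⁅ a ⁆)      ≡⟨ cong imbalance swap ⟩
      imbalance ((A ∪ ⁅ a ⁆) ∪ ⁅ y ⁆)      ≡⟨ imbalance-flip (hke y) (a , y∈p∪⁅y⁆ a) y∉A∪a ne∁′ ⟩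
      - imbalance (A ∪ ⁅ a ⁆)              ≡⟨ cong -_ (alternates (a∉A∪y ∘ x∈p∪q⁺ ∘ inj₁) ne∁″) ⟩
      - (signPow ∣ A ∣ * imbalance ⁅ a ⁆)   ≡⟨ neg-distribˡ-* (signPow ∣ A ∣) (imbalance ⁅ a ⁆) ⟩
      - signPow ∣ A ∣ * imbalance ⁅ a ⁆     ≡⟨ cong (_* imbalance ⁅ a ⁆) (sym (signPow-suc ∣ A ∣)) ⟩
      signPow (suc ∣ A ∣) * imbalance ⁅ a ⁆ ≡⟨ cong (λ n → signPow n * imbalance ⁅ a ⁆) (sym (∣p∪⁅y⁆∣≡1+∣p∣ A y y∉A)) ⟩
      signPow ∣ A ∪ ⁅ y ⁆ ∣ * imbalance ⁅ a ⁆ ∎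
      where
      swap : (A ∪ ⁅ y ⁆) ∪ ⁅ a ⁆ ≡ (A ∪ ⁅ a ⁆) ∪ ⁅ y ⁆
      swap = trans (∪-assoc A ⁅ y ⁆ ⁅ a ⁆) (trans (cong (A ∪_) (∪-comm ⁅ y ⁆ ⁅ a ⁆)) (sym (∪-assoc A ⁅ a ⁆ ⁅ y ⁆)))
      y∉A∪a : y ∉ A ∪ ⁅ a ⁆
      y∉A∪a y∈ = [ y∉A , (λ y∈⁅a⁆ → a∉A∪y (subst (_∈ A ∪ ⁅ y ⁆) (x∈⁅y⁆⇒x≡y a y∈⁅a⁆) (y∈p∪⁅y⁆ y))) ] (x∈p∪q⁻ A ⁅ a ⁆ y∈)
      ne∁′ : Nonempty (∁ ((A ∪ ⁅ a ⁆) ∪ ⁅ y ⁆))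
      ne∁′ = subst (Nonempty ∘ ∁) swap ne∁
      ne∁″ : Nonempty (∁ (A ∪ ⁅ a ⁆))
      ne∁″ = let (z , z∈) = ne∁′ in z , x∉p⇒x∈∁p (x∈∁p⇒x∉p z∈ ∘ x∈p∪q⁺ ∘ inj₁)

  excl-pair : ∀ a b → ∣ F a ∣ ≡ ∣ F b ∣ → excl ⁅ a ⁆ ⁅ b ⁆ ≡ excl ⁅ b ⁆ ⁅ a ⁆
  excl-pair a b ∣Fa∣≡∣Fb∣ = begin
    excl ⁅ a ⁆ ⁅ b ⁆   ≡⟨ cong₂ (λ I U → ∣ I ─ U ∣) (⋂[]-⁅⁆ a) (⋃[]-⁅⁆ b) ⟩
    ∣ F a ─ F b ∣      ≡⟨ cancel-middle sizes (sym ∣Fa∣≡∣Fb∣) ⟩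
    ∣ F b ─ F a ∣      ≡⟨ sym (cong₂ (λ I U → ∣ I ─ U ∣) (⋂[]-⁅⁆ b) (⋃[]-⁅⁆ a)) ⟩
    excl ⁅ b ⁆ ⁅ a ⁆   ∎
    where
    sizes : ∣ F a ─ F b ∣ + ∣ F b ∣ ≡ ∣ F a ∣ + ∣ F b ─ F a ∣
    sizes = begin
      ∣ F a ─ F b ∣ + ∣ F b ∣  ≡⟨ ∣q─p∣+∣p∣≡∣p∪q∣ (F b) (F a) ⟩
      ∣ F b ∪ F a ∣            ≡⟨ cong ∣_∣ (∪-comm (F b) (F a)) ⟩
      ∣ F a ∪ F b ∣            ≡⟨ sym (∣q─p∣+∣p∣≡∣p∪q∣ (F a) (F b)) ⟩
      ∣ F b ─ F a ∣ + ∣ F a ∣  ≡⟨ +-comm ∣ F b ─ F a ∣ ∣ F a ∣ ⟩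
      ∣ F a ∣ + ∣ F b ─ F a ∣  ∎

  -- Two singletons {a}, {b} have the same imbalance if some third index z
  -- exists: both are flipped into imbalance ({a} ∪ {b}), which misses z.
  singleton-imbalance : (∀ i → HKE-sub F (⊤ ─ ⁅ i ⁆)) → ∀ {a b z} → a ≢ b → z ≢ a → z ≢ b →
    imbalance ⁅ a ⁆ ≡ imbalance ⁅ b ⁆
  singleton-imbalance hke {a} {b} {z} a≢b z≢a z≢b = begin
    imbalance ⁅ a ⁆                 ≡⟨ sym (neg-involutive (imbalance ⁅ a ⁆)) ⟩
    - - imbalance ⁅ a ⁆             ≡⟨ cong -_ (sym (flip-into b a (a≢b ∘ sym) z≢b z≢a)) ⟩
    - imbalance (⁅ a ⁆ ∪ ⁅ b ⁆)     ≡⟨ cong (-_ ∘ imbalance) (∪-comm ⁅ a ⁆ ⁅ b ⁆) ⟩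
    - imbalance (⁅ b ⁆ ∪ ⁅ a ⁆)     ≡⟨ cong -_ (flip-into a b a≢b z≢a z≢b) ⟩
    - - imbalance ⁅ b ⁆             ≡⟨ neg-involutive (imbalance ⁅ b ⁆) ⟩
    imbalance ⁅ b ⁆                 ∎
    where
    flip-into : ∀ y c → y ≢ c → z ≢ y → z ≢ c → imbalance (⁅ c ⁆ ∪ ⁅ y ⁆) ≡ - imbalance ⁅ c ⁆
    flip-into y c y≢c z≢y z≢c = imbalance-flip (hke y) (c , x∈⁅x⁆ c) (x≢y⇒x∉⁅y⁆ y≢c)
      (z , x∉p⇒x∈∁p ([ x≢y⇒x∉⁅y⁆ z≢c , x≢y⇒x∉⁅y⁆ z≢y ] ∘ x∈p∪q⁻ ⁅ c ⁆ ⁅ y ⁆))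

third-index : ∀ {k} (a : Fin (2 + k)) → ∃[ z ] z ≢ suc a × z ≢ zero
third-index zero    = suc (suc zero) , (λ ()) , (λ ())
third-index (suc a) = suc zero , (λ ()) , (λ ())

singletons-agree : ∀ {u k α} (F : Fin (2 + k) → Subset u) → (∀ i → ∣ F i ∣ ≡ α) →
  (∀ i → HKE-sub F (⊤ ─ ⁅ i ⁆)) → ∀ a → imbalance F ⁅ a ⁆ ≡ imbalance F ⁅ zero ⁆
singletons-agree F ∣F∣≡α hke zero = refl
singletons-agree {k = zero} F ∣F∣≡α hke (suc zero) = cong₂ (λ m n → + m - + n) (sym pair) pair
  where
  pair : excl F ⁅ zero ⁆ ⁅ suc zero ⁆ ≡ excl F ⁅ suc zero ⁆ ⁅ zero ⁆
  pair = excl-pair F zero (suc zero) (trans (∣F∣≡α zero) (sym (∣F∣≡α (suc zero))))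
singletons-agree {k = suc k} F ∣F∣≡α hke (suc a) =
  let (z , z≢1+a , z≢0) = third-index a in singleton-imbalance F hke (λ ()) z≢1+a z≢0

theorem2p6 : ∀ {u k} (F : Fin k → Subset u) → Relevant F →
    (∀ (i : Fin k) → HKE-sub F (⊤ ─ ⁅ i ⁆)) →
    Σ ℤ (λ m → ∀ (Γ₁ : Subset k) → Nonempty Γ₁ → Nonempty (∁ Γ₁) →
      (+ ∣ ⋂[ F ] Γ₁ ─ ⋃[ F ] (∁ Γ₁) ∣) - (+ ∣ ⋂[ F ] (∁ Γ₁) ─ ⋃[ F ] Γ₁ ∣)
        ≡ signPow (suc ∣ Γ₁ ∣) * m)
theorem2p6 {k = zero} F (_ , () , _) _
theorem2p6 {k = suc zero} F _ _ =
  + 0 , λ { Γ₁ (zero , 0∈Γ₁) (zero , 0∈∁Γ₁) → contradiction 0∈Γ₁ (x∈∁p⇒x∉p 0∈∁Γ₁) }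
theorem2p6 {k = suc (suc k)} F (_ , _ , _ , _ , ∣F∣≡α) hke = imbalance F ⁅ zero ⁆ , alternating
  where
  -- Write Γ₁ = (Γ₁ ─ {a}) ∪ {a}, alternate down to {a}, then move to {0};
  -- the signs match since (−1)^(n+2) = (−1)^n by definition of signPow.
  alternating : ∀ Γ₁ → Nonempty Γ₁ → Nonempty (∁ Γ₁) →
    imbalance F Γ₁ ≡ signPow (suc ∣ Γ₁ ∣) * imbalance F ⁅ zero ⁆
  alternating Γ₁ (a , a∈Γ₁) ne∁ = begin
    imbalance F Γ₁                              ≡⟨ cong (imbalance F) (sym split) ⟩
    imbalance F ((Γ₁ ─ ⁅ a ⁆) ∪ ⁅ a ⁆)          ≡⟨ alternation F hke a (Γ₁ ─ ⁅ a ⁆) (y∉p─⁅y⁆ Γ₁ a) ne∁′ ⟩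
    signPow ∣ Γ₁ ─ ⁅ a ⁆ ∣ * imbalance F ⁅ a ⁆  ≡⟨ cong₂ (λ n i → signPow (suc n) * i) (sym (∣p∣≡1+∣p─⁅y⁆∣ a∈Γ₁))
                                                        (singletons-agree F ∣F∣≡α hke a) ⟩
    signPow (suc ∣ Γ₁ ∣) * imbalance F ⁅ zero ⁆ ∎
    where
    split : (Γ₁ ─ ⁅ a ⁆) ∪ ⁅ a ⁆ ≡ Γ₁
    split = p─⁅y⁆∪⁅y⁆≡p a∈Γ₁
    ne∁′ : Nonempty (∁ ((Γ₁ ─ ⁅ a ⁆) ∪ ⁅ a ⁆))
    ne∁′ = subst (Nonempty ∘ ∁) (sym split) ne∁
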